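{- Every connected and co-connected claw-free CIS graph is (isomorphic to) the line graph of a connected triangle-free multigraph.
   Context: All graphs are finite and simple unless called multigraphs. A graph is co-connected if its complement is connected. A graph is CIS if every inclusion-maximal clique intersects every inclusion-maximal stable set. The claw is $K_{1,3}$. The line graph of a multigraph $H$ is the simple graph with vertex set $E(H)$ in which two distinct edges are adjacent iff they have a common endpoint. A multigraph is triangle-free if it has no three pairwise adjacent vertices. -}

module Defs where

open import Level using (0ℓ)
open import Data.Nat using (ℕ)
open import Data.Fin using (Fin)
open import Data.Fin.Subset using (Subset; _∈_; _∉_; _⊆_)
open import Data.Product using (Σ; ∃; ∃-syntax; _×_; _,_; proj₁; proj₂)
open import Data.Sum using (_⊎_)
open import Relation.Nullary using (¬_)
open import Relation.Binary using (Decidable)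
open import Relation.Binary.PropositionalEquality using (_≡_; _≢_)
open import Function.Bundles using (_⤖_; _⇔_; Bijection)
open import Data.Fin using (_≟_)
open import Relation.Nullary using (Dec; yes; no)
open import Data.Sum using (inj₁; inj₂)
open import Relation.Binary.PropositionalEquality using (refl; sym; trans)

record Graph : Set₁ where
  field
    n       : ℕ
    Adj     : Fin n → Fin n → Set
    Adj-sym : ∀ {u v} → Adj u v → Adj v u
    Adj-irr : ∀ {u} → ¬ Adj u u
    Adj-dec : Decidable Adj
open Graph public

module _ (G : Graph) where

  NonAdj : Fin (n G) → Fin (n G) → Set
  NonAdj u v = u ≢ v × ¬ Adj G u v

  data Reach (R : Fin (n G) → Fin (n G) → Set) : Fin (n G) → Fin (n G) → Set where
    here : ∀ {u} → Reach R u u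
    step : ∀ {u w v} → R u w → Reach R w v → Reach R u v

  Connected : Set
  Connected = ∀ u v → Reach (Adj G) u v

  CoConnected : Set
  CoConnected = ∀ u v → Reach NonAdj u v

  IsClique : Subset (n G) → Set
  IsClique S = ∀ {u v} → u ∈ S → v ∈ S → u ≢ v → Adj G u v

  IsStable : Subset (n G) → Set
  IsStable S = ∀ {u v} → u ∈ S → v ∈ S → ¬ Adj G u v

  IsMaxClique : Subset (n G) → Set
  IsMaxClique S = IsClique S × (∀ T → IsClique T → S ⊆ T → T ⊆ S)

  IsMaxStable : Subset (n G) → Set
  IsMaxStable S = IsStable S × (∀ T → IsStable T → S ⊆ T → T ⊆ S)

  IsCIS : Set
  IsCIS = ∀ C I → IsMaxClique C → IsMaxStable I → ∃[ v ] (v ∈ C × v ∈ I)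

  ClawFree : Set
  ClawFree = ∀ c a b d → Adj G c a → Adj G c b → Adj G c d →
             a ≢ b → a ≢ d → b ≢ d →
             ¬ (¬ Adj G a b × ¬ Adj G a d × ¬ Adj G b d)

record _≅_ (G H : Graph) : Set where
  field
    bij  : Fin (n G) ⤖ Fin (n H)
    pres : ∀ u v → Adj G u v ⇔ Adj H (Bijection.to bij u) (Bijection.to bij v)

record Multigraph : Set where
  field
    V        : ℕ
    E        : ℕ
    ends     : Fin E → Fin V × Fin V
    loopless : ∀ e → proj₁ (ends e) ≢ proj₂ (ends e)
open Multigraph public

module _ (M : Multigraph) where

  Incident : Fin (E M) → Fin (V M) → Set
  Incident e x = proj₁ (ends M e) ≡ x ⊎ proj₂ (ends M e) ≡ x

  MAdj : Fin (V M) → Fin (V M) → Set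
  MAdj x y = ∃[ e ] ((proj₁ (ends M e) ≡ x × proj₂ (ends M e) ≡ y)
                    ⊎ (proj₁ (ends M e) ≡ y × proj₂ (ends M e) ≡ x))

  data MReach : Fin (V M) → Fin (V M) → Set where
    here : ∀ {x} → MReach x x
    step : ∀ {x y z} → MAdj x y → MReach y z → MReach x z

  MConnected : Set
  MConnected = ∀ x y → MReach x y

  TriangleFree : Set
  TriangleFree = ∀ x y z → ¬ (MAdj x y × MAdj y z × MAdj x z)

  LAdj : Fin (E M) → Fin (E M) → Set
  LAdj e f = e ≢ f × ∃[ x ] (Incident e x × Incident f x)

  private
    ends-dec : ∀ e f → Dec (∃[ x ] (Incident e x × Incident f x))
    ends-dec e f with proj₁ (ends M e) ≟ proj₁ (ends M f)
                    | proj₁ (ends M e) ≟ proj₂ (ends M f)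
                    | proj₂ (ends M e) ≟ proj₁ (ends M f)
                    | proj₂ (ends M e) ≟ proj₂ (ends M f)
    ... | yes p | _ | _ | _ = yes (_ , inj₁ refl , inj₁ (sym p))
    ... | no _ | yes p | _ | _ = yes (_ , inj₁ refl , inj₂ (sym p))
    ... | no _ | no _ | yes p | _ = yes (_ , inj₂ refl , inj₁ (sym p))
    ... | no _ | no _ | no _ | yes p = yes (_ , inj₂ refl , inj₂ (sym p))
    ... | no a | no b | no c | no d = no λ where
      (x , inj₁ p , inj₁ q) → a (trans p (sym q))
      (x , inj₁ p , inj₂ q) → b (trans p (sym q))
      (x , inj₂ p , inj₁ q) → c (trans p (sym q))
      (x , inj₂ p , inj₂ q) → d (trans p (sym q))

    LAdj-dec : Decidable LAdj
    LAdj-dec e f with e ≟ f | ends-dec e f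
    ... | yes p | _ = no λ q → proj₁ q p
    ... | no p | yes q = yes (p , q)
    ... | no p | no q = no λ r → q (proj₂ r)

  LineGraph : Graph
  LineGraph = record
    { n       = E M
    ; Adj     = LAdj
    ; Adj-sym = λ { (p , x , i , j) → (λ q → p (sym q)) , x , j , i }
    ; Adj-irr = λ q → proj₁ q refl
    ; Adj-dec = LAdj-dec
    }

-- The root multigraph H of G is built directly: its nodes are the maximal cliques of G plus one
-- pendant node for every simplicial vertex, and every vertex of G becomes an edge of H joining the
-- nodes that contain it. Everything rests on a twin property of diamonds: if u v is an edge with
-- two non-adjacent common neighbours, then every other neighbour of u is a neighbour of v. With
-- it, a non-simplicial vertex v with non-adjacent neighbours u, w lies only in the maximal cliques
-- through v u and v w, and three pairwise intersecting maximal cliques share a vertex; so each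
-- vertex is an edge with exactly two ends, two vertices share an end iff they are adjacent, and H
-- has no triangle. The diamond property reduces to excluding an induced 4-wheel, which is where
-- connectivity of G and of its complement enter: since CIS and claw-freeness make every maximal
-- clique through c meet every non-edge inside N(c), a wheel with hub c would make the neighbours
-- of c that miss another neighbour of c a proper non-empty set complete to the rest of G.

module Submission where

open import Defs
import Data.Bool.Properties as Bool
open import Data.Empty using (⊥; ⊥-elim)
open import Data.Fin using (Fin; zero; suc; _≟_)
open import Data.Fin.Properties using (any?)
open import Data.Fin.Subset using (Subset; _∈_; _∉_; _⊆_; ⁅_⁆; _∪_)
open import Data.Fin.Subset.Properties
  using (_∈?_; x∈⁅x⁆; x∈⁅y⁆⇒x≡y; x∈p∪q⁻; p⊆p∪q; q⊆p∪q; ⊆-antisym)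
open import Data.List using (List; []; _∷_; foldl; length; lookup; deduplicate; concatMap; allFin)
import Data.List.Membership.Propositional as List
open import Data.List.Membership.Propositional.Properties
  using (∈-allFin; ∈-lookup; ∈-deduplicate⁺; ∈-deduplicate⁻; ∈-concatMap⁺; ∈-concatMap⁻)
import Data.List.Relation.Unary.All as All
open import Data.List.Relation.Unary.AllPairs using (_∷_)
open import Data.List.Relation.Unary.Any as Any using (here; there)
open import Data.List.Relation.Unary.Any.Properties using (lookup-index)
open import Data.List.Relation.Unary.Unique.DecPropositional.Properties using (deduplicate-!)
open import Data.List.Relation.Unary.Unique.Propositional using (Unique)
open import Data.Nat using (ℕ)
open import Data.Product using (Σ-syntax; ∃-syntax; _×_; _,_; proj₁; proj₂)
open import Data.Sum using (_⊎_; inj₁; inj₂; [_,_]′; swap; map; map₁)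
open import Data.Sum.Properties as Sum using (inj₁-injective)
import Data.Vec.Properties as Vec
open import Function.Bundles using (mk⇔)
open import Function.Construct.Identity using (⤖-id)
open import Relation.Binary.Definitions using (Decidable; DecidableEquality; Symmetric)
open import Relation.Binary.PropositionalEquality using (_≡_; _≢_; refl; sym; trans; cong; subst; ≢-sym)
open import Relation.Nullary using (¬_; yes; no)
open import Relation.Nullary.Decidable using (¬?; _×-dec_; decidable-stable)

module PairwiseSets {N : ℕ} (R : Fin N → Fin N → Set) (R-sym : Symmetric R) where

  Pairwise : Subset N → Set
  Pairwise S = ∀ {u v} → u ∈ S → v ∈ S → u ≢ v → R u v

  Maximal : Subset N → Set
  Maximal S = Pairwise S × (∀ T → Pairwise T → S ⊆ T → T ⊆ S)

  Compatible : Subset N → Fin N → Set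
  Compatible S v = ∀ {u} → u ∈ S → u ≢ v → R u v

  Blocked : Subset N → Fin N → Set
  Blocked S v = ∃[ u ] (u ∈ S × u ≢ v × ¬ R u v)

  ⁅⁆-pairwise : ∀ v → Pairwise ⁅ v ⁆
  ⁅⁆-pairwise v u∈ w∈ u≢w = ⊥-elim (u≢w (trans (x∈⁅y⁆⇒x≡y v u∈) (sym (x∈⁅y⁆⇒x≡y v w∈))))

  ∪-pairwise : ∀ {S T} → Pairwise S → Pairwise T →
               (∀ {u v} → u ∈ S → v ∈ T → u ≢ v → R u v) → Pairwise (S ∪ T)
  ∪-pairwise {S} {T} pS pT cross {u} {v} u∈ v∈ with x∈p∪q⁻ S T u∈ | x∈p∪q⁻ S T v∈
  ... | inj₁ u∈S | inj₁ v∈S = pS u∈S v∈S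
  ... | inj₁ u∈S | inj₂ v∈T = cross u∈S v∈T
  ... | inj₂ u∈T | inj₁ v∈S = λ u≢v → R-sym (cross v∈S u∈T (≢-sym u≢v))
  ... | inj₂ u∈T | inj₂ v∈T = pT u∈T v∈T

  ∪⁅⁆-pairwise : ∀ {S v} → Pairwise S → Compatible S v → Pairwise (S ∪ ⁅ v ⁆)
  ∪⁅⁆-pairwise {S} {v} pS cS = ∪-pairwise pS (⁅⁆-pairwise v) cross
    where
    cross : ∀ {u w} → u ∈ S → w ∈ ⁅ v ⁆ → u ≢ w → R u w
    cross u∈S w∈ with x∈⁅y⁆⇒x≡y v w∈
    ... | refl = cS u∈S

  ⁅⁆-compatible : ∀ {u v} → R u v → Compatible ⁅ u ⁆ v
  ⁅⁆-compatible {u} Ruv x∈ _ with x∈⁅y⁆⇒x≡y u x∈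
  ... | refl = Ruv

  ∪-compatible : ∀ {S T v} → Compatible S v → Compatible T v → Compatible (S ∪ T) v
  ∪-compatible {S} {T} cS cT x∈ with x∈p∪q⁻ S T x∈
  ... | inj₁ x∈S = cS x∈S
  ... | inj₂ x∈T = cT x∈T

  compatible⇒∈ : ∀ {S v} → Maximal S → Compatible S v → v ∈ S
  compatible⇒∈ {S} {v} (pS , maxS) cS =
    maxS (S ∪ ⁅ v ⁆) (∪⁅⁆-pairwise pS cS) (p⊆p∪q ⁅ v ⁆) (q⊆p∪q S ⁅ v ⁆ (x∈⁅x⁆ v))

  maximal-unique : ∀ {S T} → Maximal S → Maximal T →
                   (∀ {u v} → u ∈ S → v ∈ T → u ≢ v → R u v) → S ≡ T
  maximal-unique {S} {T} (pS , maxS) (pT , maxT) cross = ⊆-antisym S⊆T T⊆S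
    where
    T⊆S : T ⊆ S
    T⊆S v∈T = maxS (S ∪ T) (∪-pairwise pS pT cross) (p⊆p∪q T) (q⊆p∪q S T v∈T)
    S⊆T : S ⊆ T
    S⊆T = maxT S pS T⊆S

module GreedyExtension {N : ℕ} (R : Fin N → Fin N → Set) (R? : Decidable R) (R-sym : Symmetric R) where

  open PairwiseSets R R-sym

  blocked-or-compatible : ∀ S v → Blocked S v ⊎ Compatible S v
  blocked-or-compatible S v with any? (λ u → u ∈? S ×-dec ¬? (u ≟ v) ×-dec ¬? (R? u v))
  ... | yes blocked = inj₁ blocked
  ... | no ¬blocked = inj₂ λ {u} u∈S u≢v →
    decidable-stable (R? u v) (λ ¬Ruv → ¬blocked (u , u∈S , u≢v , ¬Ruv))

  ∉⇒blocked : ∀ {S v} → Maximal S → v ∉ S → Blocked S v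
  ∉⇒blocked {S} {v} maxS v∉S with blocked-or-compatible S v
  ... | inj₁ blocked = blocked
  ... | inj₂ compatible = ⊥-elim (v∉S (compatible⇒∈ maxS compatible))

  insert : Subset N → Fin N → Subset N
  insert S v with blocked-or-compatible S v
  ... | inj₁ _ = S
  ... | inj₂ _ = S ∪ ⁅ v ⁆

  insert-⊇ : ∀ S v → S ⊆ insert S v
  insert-⊇ S v with blocked-or-compatible S v
  ... | inj₁ _ = λ u∈ → u∈
  ... | inj₂ _ = p⊆p∪q ⁅ v ⁆

  insert-pairwise : ∀ S v → Pairwise S → Pairwise (insert S v)
  insert-pairwise S v pS with blocked-or-compatible S v
  ... | inj₁ _ = pS
  ... | inj₂ cS = ∪⁅⁆-pairwise pS cS

  insert-saturates : ∀ S v → v ∈ insert S v ⊎ Blocked S v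
  insert-saturates S v with blocked-or-compatible S v
  ... | inj₁ blocked = inj₂ blocked
  ... | inj₂ _ = inj₁ (q⊆p∪q S ⁅ v ⁆ (x∈⁅x⁆ v))

  grow : Subset N → List (Fin N) → Subset N
  grow = foldl insert

  grow-⊇ : ∀ S vs → S ⊆ grow S vs
  grow-⊇ S [] u∈ = u∈
  grow-⊇ S (v ∷ vs) u∈ = grow-⊇ (insert S v) vs (insert-⊇ S v u∈)

  grow-pairwise : ∀ S vs → Pairwise S → Pairwise (grow S vs)
  grow-pairwise S [] pS = pS
  grow-pairwise S (v ∷ vs) pS = grow-pairwise (insert S v) vs (insert-pairwise S v pS)

  grow-saturates : ∀ S {vs v} → v List.∈ vs → v ∈ grow S vs ⊎ Blocked (grow S vs) v
  grow-saturates S {v ∷ vs} (here refl) with insert-saturates S v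
  ... | inj₁ v∈ = inj₁ (grow-⊇ (insert S v) vs v∈)
  ... | inj₂ (u , u∈S , u≢v , ¬Ruv) =
    inj₂ (u , grow-⊇ (insert S v) vs (insert-⊇ S v u∈S) , u≢v , ¬Ruv)
  grow-saturates S {w ∷ vs} (there v∈vs) = grow-saturates (insert S w) v∈vs

  extend-maximal : ∀ {S} → Pairwise S → Σ[ T ∈ Subset N ] (Maximal T × S ⊆ T)
  extend-maximal {S} pS = T , (grow-pairwise S (allFin N) pS , maxT) , grow-⊇ S (allFin N)
    where
    T : Subset N
    T = grow S (allFin N)
    maxT : ∀ T′ → Pairwise T′ → T ⊆ T′ → T′ ⊆ T
    maxT T′ pT′ T⊆T′ {v} v∈T′ with grow-saturates S (∈-allFin v)
    ... | inj₁ v∈T = v∈T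
    ... | inj₂ (u , u∈T , u≢v , ¬Ruv) = ⊥-elim (¬Ruv (pT′ (T⊆T′ u∈T) v∈T′ u≢v))

module GraphBasics (G : Graph) where

  N : ℕ
  N = n G

  infix 4 _~_
  _~_ : Fin N → Fin N → Set
  _~_ = Adj G

  ~-sym : Symmetric _~_
  ~-sym = Adj-sym G

  ~-irr : ∀ {u} → ¬ u ~ u
  ~-irr = Adj-irr G

  _~?_ : Decidable _~_
  _~?_ = Adj-dec G

  infix 4 _~⁼_
  _~⁼_ : Fin N → Fin N → Set
  u ~⁼ v = u ≡ v ⊎ u ~ v

  ~⇒≢ : ∀ {u v} → u ~ v → u ≢ v
  ~⇒≢ u~v refl = ~-irr u~v

  ≁-sym : ∀ {u v} → ¬ u ~ v → ¬ v ~ u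
  ≁-sym ¬u~v v~u = ¬u~v (~-sym v~u)

  open PairwiseSets _~_ ~-sym public
    using (Compatible; ⁅⁆-pairwise; ⁅⁆-compatible; ∪-compatible; ∪⁅⁆-pairwise; compatible⇒∈; maximal-unique)
  open GreedyExtension _~_ _~?_ ~-sym public using (∉⇒blocked)

  maxClique-~⁼ : ∀ {K u v} → IsMaxClique G K → u ∈ K → v ∈ K → u ~⁼ v
  maxClique-~⁼ {u = u} {v} (clique , _) u∈ v∈ with u ≟ v
  ... | yes u≡v = inj₁ u≡v
  ... | no u≢v = inj₂ (clique u∈ v∈ u≢v)

  maxClique-⊇ : ∀ {S} → IsClique G S → Σ[ K ∈ Subset N ] (IsMaxClique G K × S ⊆ K)
  maxClique-⊇ = GreedyExtension.extend-maximal _~_ _~?_ ~-sym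

  maxClique-∋ : ∀ v → Σ[ K ∈ Subset N ] (IsMaxClique G K × v ∈ K)
  maxClique-∋ v with maxClique-⊇ (⁅⁆-pairwise v)
  ... | K , maxK , ⊇v = K , maxK , ⊇v (x∈⁅x⁆ v)

  maxClique-∋₂ : ∀ {u v} → u ~ v → Σ[ K ∈ Subset N ] (IsMaxClique G K × u ∈ K × v ∈ K)
  maxClique-∋₂ {u} {v} u~v with maxClique-⊇ (∪⁅⁆-pairwise (⁅⁆-pairwise u) (⁅⁆-compatible u~v))
  ... | K , maxK , ⊇uv =
    K , maxK , ⊇uv (p⊆p∪q ⁅ v ⁆ (x∈⁅x⁆ u)) , ⊇uv (q⊆p∪q ⁅ u ⁆ ⁅ v ⁆ (x∈⁅x⁆ v))

  maxClique-∋₃ : ∀ {u v w} → u ~ v → v ~ w → u ~ w →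
                 Σ[ K ∈ Subset N ] (IsMaxClique G K × u ∈ K × v ∈ K × w ∈ K)
  maxClique-∋₃ {u} {v} {w} u~v v~w u~w
    with maxClique-⊇ (∪⁅⁆-pairwise (∪⁅⁆-pairwise (⁅⁆-pairwise u) (⁅⁆-compatible u~v))
                                   (∪-compatible (⁅⁆-compatible u~w) (⁅⁆-compatible v~w)))
  ... | K , maxK , ⊇uvw =
    K , maxK , ⊇uvw (p⊆p∪q ⁅ w ⁆ (p⊆p∪q ⁅ v ⁆ (x∈⁅x⁆ u)))
      , ⊇uvw (p⊆p∪q ⁅ w ⁆ (q⊆p∪q ⁅ u ⁆ ⁅ v ⁆ (x∈⁅x⁆ v)))
      , ⊇uvw (q⊆p∪q (⁅ u ⁆ ∪ ⁅ v ⁆) ⁅ w ⁆ (x∈⁅x⁆ w))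

  module Independent = PairwiseSets (λ u v → ¬ u ~ v) ≁-sym

  maxStable-⊇ : ∀ {S} → Independent.Pairwise S → Σ[ I ∈ Subset N ] (IsMaxStable G I × S ⊆ I)
  maxStable-⊇ independentS
    with GreedyExtension.extend-maximal (λ u v → ¬ u ~ v) (λ u v → ¬? (u ~? v)) ≁-sym independentS
  ... | I , (independentI , maxI) , S⊆I =
    I , (stableI , λ T stableT → maxI T (λ u∈ v∈ _ → stableT u∈ v∈)) , S⊆I
    where
    stableI : IsStable G I
    stableI {u} {v} u∈ v∈ with u ≟ v
    ... | yes refl = ~-irr
    ... | no u≢v = independentI u∈ v∈ u≢v

  Reach-invariant : ∀ {R u v} (P : Fin N → Set) → (∀ {x y} → R x y → P x → P y) →
                    Reach G R u v → P u → P v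
  Reach-invariant P preserve here Pu = Pu
  Reach-invariant P preserve (step uRw w⇝v) Pu = Reach-invariant P preserve w⇝v (preserve uRw Pu)

  coConnected⇒¬split : CoConnected G → (P : Fin N → Set) →
                       (∀ {u v} → ¬ P u → P v → u ≢ v → u ~ v) → ∀ {u v} → ¬ P u → ¬ P v
  coConnected⇒¬split coconnected P complete {u} {v} =
    Reach-invariant (λ x → ¬ P x) (λ (x≢y , x≁y) ¬Px Py → x≁y (complete ¬Px Py x≢y)) (coconnected u v)

  Simplicial : Fin N → Set
  Simplicial v = ∀ {u w} → v ~ u → v ~ w → u ≢ w → u ~ w

  NonSimplicial : Fin N → Set
  NonSimplicial v = ∃[ u ] ∃[ w ] (v ~ u × v ~ w × u ≢ w × ¬ u ~ w)

  nonSimplicial-or-simplicial : ∀ v → NonSimplicial v ⊎ Simplicial v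
  nonSimplicial-or-simplicial v
    with any? (λ u → any? (λ w → v ~? u ×-dec v ~? w ×-dec ¬? (u ≟ w) ×-dec ¬? (u ~? w)))
  ... | yes (u , w , witness) = inj₁ (u , w , witness)
  ... | no none = inj₂ λ {u} {w} v~u v~w u≢w →
    decidable-stable (u ~? w) (λ u≁w → none (u , w , v~u , v~w , u≢w , u≁w))

  simplicial⇒unique-maxClique : ∀ {v K K′} → Simplicial v → IsMaxClique G K → IsMaxClique G K′ →
                                v ∈ K → v ∈ K′ → K ≡ K′
  simplicial⇒unique-maxClique {v} {K} {K′} simplicial maxK maxK′ v∈K v∈K′ =
    maximal-unique maxK maxK′ cross
    where
    cross : ∀ {a b} → a ∈ K → b ∈ K′ → a ≢ b → a ~ b
    cross {a} {b} a∈ b∈ a≢b with a ≟ v | b ≟ v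
    ... | yes refl | _ = proj₁ maxK′ v∈K′ b∈ a≢b
    ... | no _ | yes refl = proj₁ maxK a∈ v∈K a≢b
    ... | no a≢v | no b≢v =
      simplicial (proj₁ maxK v∈K a∈ (≢-sym a≢v)) (proj₁ maxK′ v∈K′ b∈ (≢-sym b≢v)) a≢b

module CISGraph (G : Graph) (cis : IsCIS G) where

  open GraphBasics G

  nonEdge-¬dominates : ∀ {C y q} → IsMaxClique G C → ¬ y ~ q →
                       ¬ (∀ {k} → k ∈ C → k ~ y ⊎ k ~ q)
  nonEdge-¬dominates {C} {y} {q} maxC y≁q dominates
    with maxStable-⊇ (Independent.∪⁅⁆-pairwise (Independent.⁅⁆-pairwise y)
                                               (Independent.⁅⁆-compatible y≁q))
  ... | I , maxI@(stableI , _) , ⊇yq with cis C I maxC maxI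
  ...   | v , v∈C , v∈I with dominates v∈C
  ...     | inj₁ v~y = stableI v∈I (⊇yq (p⊆p∪q ⁅ q ⁆ (x∈⁅x⁆ y))) v~y
  ...     | inj₂ v~q = stableI v∈I (⊇yq (q⊆p∪q ⁅ y ⁆ ⁅ q ⁆ (x∈⁅x⁆ q))) v~q

module ClawFreeCIS (G : Graph) (claw-free : ClawFree G) (cis : IsCIS G) where

  open GraphBasics G
  open CISGraph G cis

  no-claw : ∀ {c a b d} → c ~ a → c ~ b → c ~ d → a ≢ b → a ≢ d → b ≢ d →
            ¬ a ~ b → ¬ a ~ d → ¬ b ~ d → ⊥
  no-claw c~a c~b c~d a≢b a≢d b≢d a≁b a≁d b≁d =
    claw-free _ _ _ _ c~a c~b c~d a≢b a≢d b≢d (a≁b , a≁d , b≁d)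

  claw-pair : ∀ {r q s t} → r ~ q → r ~ s → r ~ t → q ≢ s → q ≢ t → s ≢ t → ¬ s ~ t →
              q ~ s ⊎ q ~ t
  claw-pair {q = q} {s} {t} r~q r~s r~t q≢s q≢t s≢t s≁t with q ~? s | q ~? t
  ... | yes q~s | _ = inj₁ q~s
  ... | no _ | yes q~t = inj₂ q~t
  ... | no q≁s | no q≁t = ⊥-elim (no-claw r~q r~s r~t q≢s q≢t s≢t q≁s q≁t s≁t)

  maxClique-meets-nonEdge : ∀ {C c u v} → IsMaxClique G C → c ∈ C → c ~ u → c ~ v →
                            ¬ u ~ v → u ≢ v → u ∈ C ⊎ v ∈ C
  maxClique-meets-nonEdge {C} {c} {u} {v} maxC c∈C c~u c~v u≁v u≢v with u ∈? C | v ∈? C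
  ... | yes u∈C | _ = inj₁ u∈C
  ... | no _ | yes v∈C = inj₂ v∈C
  ... | no u∉C | no v∉C = ⊥-elim (nonEdge-¬dominates maxC u≁v dominates)
    where
    dominates : ∀ {k} → k ∈ C → k ~ u ⊎ k ~ v
    dominates {k} k∈C with k ≟ c
    ... | yes refl = inj₁ c~u
    ... | no k≢c with k ~? u | k ~? v
    ...   | yes k~u | _ = inj₁ k~u
    ...   | no _ | yes k~v = inj₂ k~v
    ...   | no k≁u | no k≁v =
      ⊥-elim (no-claw c~u c~v (proj₁ maxC c∈C k∈C (≢-sym k≢c)) u≢v
                (λ { refl → u∉C k∈C }) (λ { refl → v∉C k∈C }) u≁v (≁-sym k≁u) (≁-sym k≁v))

  diamond-¬one-sided-nbr : ∀ {u v x y z} → u ~ v → x ~ u → x ~ v → y ~ u → y ~ v → ¬ x ~ y → x ≢ y →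
                      z ~ u → ¬ z ~ v → z ~ y → ¬ z ~ x → ⊥
  diamond-¬one-sided-nbr {u} {v} {x} {y} {z} u~v x~u x~v y~u y~v x≁y x≢y z~u z≁v z~y z≁x
    with maxClique-∋₃ y~u u~v y~v
  ... | K , maxK , y∈ , u∈ , v∈ = nonEdge-¬dominates maxK z≁x dominates
    where
    dominates : ∀ {k} → k ∈ K → k ~ z ⊎ k ~ x
    dominates {k} k∈ with k ~? z | k ~? x
    ... | yes k~z | _ = inj₁ k~z
    ... | no _ | yes k~x = inj₂ k~x
    ... | no k≁z | no k≁x with k ≟ u
    ...   | yes refl = ⊥-elim (k≁z (~-sym z~u))
    ...   | no k≢u =
      ⊥-elim (no-claw (~-sym z~u) (~-sym x~u) (proj₁ maxK u∈ k∈ (≢-sym k≢u)) z≢x z≢k x≢k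
                      z≁x (≁-sym k≁z) (≁-sym k≁x))
      where
      z≢x : z ≢ x
      z≢x refl = z≁v x~v
      z≢k : z ≢ k
      z≢k refl with maxClique-~⁼ maxK k∈ v∈
      ... | inj₁ refl = z≁x (~-sym x~v)
      ... | inj₂ z~v = z≁v z~v
      x≢k : x ≢ k
      x≢k refl = x≁y (proj₁ maxK k∈ y∈ x≢y)

module WheelFree (G : Graph) (connected : Connected G) (coconnected : CoConnected G)
                 (claw-free : ClawFree G) (cis : IsCIS G) where

  open GraphBasics G
  open CISGraph G cis
  open ClawFreeCIS G claw-free cis

  -- Hub c joined to the induced 4-cycle a – d – b – x – a. In the lemmas below, an "outer"
  -- vertex q is one with ¬ c ~ q.
  record Wheel (c a b d x : Fin N) : Set where
    field
      c~a : c ~ a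
      c~b : c ~ b
      c~d : c ~ d
      c~x : c ~ x
      a~d : a ~ d
      a~x : a ~ x
      b~d : b ~ d
      b~x : b ~ x
      a≁b : ¬ a ~ b
      d≁x : ¬ d ~ x
      a≢b : a ≢ b
      d≢x : d ≢ x

  swap-ab : ∀ {c a b d x} → Wheel c a b d x → Wheel c b a d x
  swap-ab w = record
    { c~a = c~b ; c~b = c~a ; c~d = c~d ; c~x = c~x ; a~d = b~d ; a~x = b~x ; b~d = a~d ; b~x = a~x
    ; a≁b = ≁-sym a≁b ; d≁x = d≁x ; a≢b = ≢-sym a≢b ; d≢x = d≢x }
    where open Wheel w

  swap-rims : ∀ {c a b d x} → Wheel c a b d x → Wheel c d x a b
  swap-rims w = record
    { c~a = c~d ; c~b = c~x ; c~d = c~a ; c~x = c~b ; a~d = ~-sym a~d ; a~x = ~-sym b~d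
    ; b~d = ~-sym a~x ; b~x = ~-sym b~x ; a≁b = d≁x ; d≁x = a≁b ; a≢b = d≢x ; d≢x = a≢b }
    where open Wheel w

  ≁⇒≢ : ∀ {c q r} → ¬ c ~ q → c ~ r → q ≢ r
  ≁⇒≢ c≁q c~r refl = c≁q c~r

  module _ {c a b d x} (W : Wheel c a b d x) where

    open Wheel W

    hub-nbr-≁a⇒~d×~x : ∀ {u} → c ~ u → ¬ a ~ u → a ≢ u → u ~ d × u ~ x
    hub-nbr-≁a⇒~d×~x {u} c~u a≁u a≢u = through c~d b~d a~d , through c~x b~x a~x
      where
      through : ∀ {r} → c ~ r → b ~ r → a ~ r → u ~ r
      through c~r b~r a~r with maxClique-∋₃ c~b b~r c~r
      ... | K , maxK , c∈ , b∈ , r∈ with maxClique-meets-nonEdge maxK c∈ c~u c~a (≁-sym a≁u) (≢-sym a≢u)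
      ...   | inj₂ a∈ = ⊥-elim (a≁b (proj₁ maxK a∈ b∈ a≢b))
      ...   | inj₁ u∈ with maxClique-~⁼ maxK u∈ r∈
      ...     | inj₁ refl = ⊥-elim (a≁u a~r)
      ...     | inj₂ u~r = u~r

    hub-nonEdge-≁a⇒~⁼d×~⁼x : ∀ {u v} → c ~ u → c ~ v → ¬ a ~ u → a ≢ u → ¬ u ~ v → u ≢ v →
                            v ~⁼ d × v ~⁼ x
    hub-nonEdge-≁a⇒~⁼d×~⁼x {u} {v} c~u c~v a≁u a≢u u≁v u≢v = through c~d a~d , through c~x a~x
      where
      through : ∀ {r} → c ~ r → a ~ r → v ~⁼ r
      through c~r a~r with maxClique-∋₃ c~a a~r c~r
      ... | K , maxK , c∈ , a∈ , r∈ with maxClique-meets-nonEdge maxK c∈ c~u c~v u≁v u≢v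
      ...   | inj₁ u∈ = ⊥-elim (a≁u (proj₁ maxK a∈ u∈ a≢u))
      ...   | inj₂ v∈ = maxClique-~⁼ maxK v∈ r∈

    outer-meets-opposite-rim : ∀ {q} → ¬ c ~ q → q ~ a ⊎ q ~ b → q ~ d ⊎ q ~ x
    outer-meets-opposite-rim c≁q (inj₁ q~a) =
      claw-pair (~-sym q~a) a~d a~x (≁⇒≢ c≁q c~d) (≁⇒≢ c≁q c~x) d≢x d≁x
    outer-meets-opposite-rim c≁q (inj₂ q~b) =
      claw-pair (~-sym q~b) b~d b~x (≁⇒≢ c≁q c~d) (≁⇒≢ c≁q c~x) d≢x d≁x

    outer-meets-rim-via-≁a : ∀ {q w} → ¬ c ~ q → q ~ w → c ~ w → ¬ w ~ a → q ~ a ⊎ (q ~ d ⊎ q ~ x)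
    outer-meets-rim-via-≁a {q} {w} c≁q q~w c~w w≁a with w ≟ a
    ... | yes refl = inj₁ q~w
    ... | no w≢a with hub-nbr-≁a⇒~d×~x c~w (≁-sym w≁a) (≢-sym w≢a)
    ...   | w~d , w~x = inj₂ (claw-pair (~-sym q~w) w~d w~x (≁⇒≢ c≁q c~d) (≁⇒≢ c≁q c~x) d≢x d≁x)

    outer~a-meets-hub-nonEdge-≁a : ∀ {q s t} → ¬ c ~ q → q ~ a → q ~ d ⊎ q ~ x →
                                              c ~ s → c ~ t → ¬ s ~ t → s ≢ t → ¬ a ~ s → q ~ s ⊎ q ~ t
    outer~a-meets-hub-nonEdge-≁a {q} {s} {t} c≁q q~a q~rim c~s c~t s≁t s≢t a≁s
      with q ~? s | q ~? t
    ... | yes q~s | _ = inj₁ q~s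
    ... | no _ | yes q~t = inj₂ q~t
    ... | no q≁s | no q≁t with a ≟ s
    ...   | yes refl = ⊥-elim (q≁s q~a)
    ...   | no a≢s
      with hub-nbr-≁a⇒~d×~x c~s a≁s a≢s | hub-nonEdge-≁a⇒~⁼d×~⁼x c~s c~t a≁s a≢s s≁t s≢t
    ...     | s~d , s~x | t≃d , t≃x = ⊥-elim ([ claw-at s~d t≃d , claw-at s~x t≃x ]′ q~rim)
      where
      claw-at : ∀ {r} → s ~ r → t ~⁼ r → q ~ r → ⊥
      claw-at s~r (inj₁ refl) q~t = q≁t q~t
      claw-at s~r (inj₂ t~r) q~r =
        no-claw (~-sym q~r) (~-sym s~r) (~-sym t~r) (≁⇒≢ c≁q c~s) (≁⇒≢ c≁q c~t) s≢t q≁s q≁t s≁t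

    outer~a-meets-hub-nonEdge : ∀ {q u v} → ¬ c ~ q → q ~ a → q ~ d ⊎ q ~ x →
                                     c ~ u → c ~ v → ¬ u ~ v → u ≢ v → q ~ u ⊎ q ~ v
    outer~a-meets-hub-nonEdge {q} {u} {v} c≁q q~a q~rim c~u c~v u≁v u≢v with a ~? u | a ~? v
    ... | yes a~u | yes a~v = claw-pair (~-sym q~a) a~u a~v (≁⇒≢ c≁q c~u) (≁⇒≢ c≁q c~v) u≢v u≁v
    ... | no a≁u | _ = outer~a-meets-hub-nonEdge-≁a c≁q q~a q~rim c~u c~v u≁v u≢v a≁u
    ... | yes _ | no a≁v =
      swap (outer~a-meets-hub-nonEdge-≁a c≁q q~a q~rim c~v c~u (≁-sym u≁v) (≢-sym u≢v) a≁v)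

  module _ {c a b d x} (W : Wheel c a b d x) where

    open Wheel W

    outer-meets-rim : ∀ {q w} → ¬ c ~ q → q ~ w → c ~ w → (q ~ a ⊎ q ~ b) ⊎ (q ~ d ⊎ q ~ x)
    outer-meets-rim {q} {w} c≁q q~w c~w with w ~? a | w ~? b
    ... | yes w~a | yes w~b =
      inj₁ (claw-pair (~-sym q~w) w~a w~b (≁⇒≢ c≁q c~a) (≁⇒≢ c≁q c~b) a≢b a≁b)
    ... | no w≁a | _ = map₁ inj₁ (outer-meets-rim-via-≁a W c≁q q~w c~w w≁a)
    ... | yes _ | no w≁b = map₁ inj₂ (outer-meets-rim-via-≁a (swap-ab W) c≁q q~w c~w w≁b)

    outer-meets-both-rims : ∀ {q w} → ¬ c ~ q → q ~ w → c ~ w → (q ~ a ⊎ q ~ b) × (q ~ d ⊎ q ~ x)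
    outer-meets-both-rims c≁q q~w c~w with outer-meets-rim c≁q q~w c~w
    ... | inj₁ q~ab = q~ab , outer-meets-opposite-rim W c≁q q~ab
    ... | inj₂ q~dx = outer-meets-opposite-rim (swap-rims W) c≁q q~dx , q~dx

    outer-meets-hub-nonEdge : ∀ {q w u v} → ¬ c ~ q → q ~ w → c ~ w →
                              c ~ u → c ~ v → ¬ u ~ v → u ≢ v → q ~ u ⊎ q ~ v
    outer-meets-hub-nonEdge c≁q q~w c~w with outer-meets-both-rims c≁q q~w c~w
    ... | inj₁ q~a , q~dx = outer~a-meets-hub-nonEdge W c≁q q~a q~dx
    ... | inj₂ q~b , q~dx = outer~a-meets-hub-nonEdge (swap-ab W) c≁q q~b q~dx

  Deficient : Fin N → Fin N → Set
  Deficient c y = c ~ y × ∃[ k ] (c ~ k × k ≢ y × ¬ k ~ y)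

  module _ {c a b d x} (W : Wheel c a b d x) where

    open Wheel W

    outer-complete-to-deficient : ∀ {q w y} → ¬ c ~ q → q ~ w → c ~ w → Deficient c y → q ~ y
    outer-complete-to-deficient {q} {w} {y} c≁q q~w c~w (c~y , k , c~k , k≢y , k≁y) with q ~? y
    ... | yes q~y = q~y
    ... | no q≁y with maxClique-∋₂ c~k
    ...   | C , maxC , c∈ , k∈ = ⊥-elim (nonEdge-¬dominates maxC (≁-sym q≁y) dominates)
      where
      dominates : ∀ {k′} → k′ ∈ C → k′ ~ y ⊎ k′ ~ q
      dominates {k′} k′∈ with k′ ≟ c | k′ ~? y
      ... | yes refl | _ = inj₁ c~y
      ... | no _ | yes k′~y = inj₁ k′~y
      ... | no k′≢c | no k′≁y with k′ ≟ y
      ...   | yes refl = ⊥-elim (k≁y (proj₁ maxC k∈ k′∈ k≢y))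
      ...   | no k′≢y
        with outer-meets-hub-nonEdge W c≁q q~w c~w (proj₁ maxC c∈ k′∈ (≢-sym k′≢c)) c~y k′≁y k′≢y
      ...     | inj₁ q~k′ = inj₂ (~-sym q~k′)
      ...     | inj₂ q~y = ⊥-elim (q≁y q~y)

    Near : Fin N → Set
    Near u = c ~ u ⊎ (∀ {y} → Deficient c y → u ~ y)

    near-step : ∀ {u v} → u ~ v → Near u → Near v
    near-step {u} {v} u~v near-u with c ~? v
    ... | yes c~v = inj₁ c~v
    ... | no c≁v = inj₂ (complete near-u)
      where
      complete : Near u → ∀ {y} → Deficient c y → v ~ y
      complete (inj₁ c~u) = outer-complete-to-deficient c≁v (~-sym u~v) c~u
      complete (inj₂ u-complete) with any? (λ w → c ~? w ×-dec v ~? w)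
      ... | yes (w , c~w , v~w) = outer-complete-to-deficient c≁v v~w c~w
      ... | no none = ⊥-elim (no-claw u~v u~a u~b (≁⇒≢ c≁v c~a) (≁⇒≢ c≁v c~b) a≢b
                                       (λ v~a → none (a , c~a , v~a)) (λ v~b → none (b , c~b , v~b)) a≁b)
        where
        u~a : u ~ a
        u~a = u-complete (c~a , b , c~b , ≢-sym a≢b , ≁-sym a≁b)
        u~b : u ~ b
        u~b = u-complete (c~b , a , c~a , a≢b , a≁b)

    deficient-complete : ∀ {u y} → ¬ Deficient c u → Deficient c y → u ≢ y → u ~ y
    deficient-complete {u} {y} ¬deficient-u deficient-y u≢y
      with Reach-invariant Near near-step (connected c u) (inj₂ proj₁)
    ... | inj₂ u-complete = u-complete deficient-y
    ... | inj₁ c~u with u ~? y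
    ...   | yes u~y = u~y
    ...   | no u≁y = ⊥-elim (¬deficient-u (c~u , y , proj₁ deficient-y , ≢-sym u≢y , ≁-sym u≁y))

  no-wheel : ∀ {c a b d x} → ¬ Wheel c a b d x
  no-wheel {c} {a} {b} W = coConnected⇒¬split coconnected (Deficient c) (deficient-complete W)
                 (λ deficient-c → ~-irr (proj₁ deficient-c)) (c~a , b , c~b , ≢-sym a≢b , ≁-sym a≁b)
    where open Wheel W

module MaximalCliques (G : Graph) (connected : Connected G) (coconnected : CoConnected G)
                      (claw-free : ClawFree G) (cis : IsCIS G) where

  open GraphBasics G
  open ClawFreeCIS G claw-free cis
  open WheelFree G connected coconnected claw-free cis

  diamond-twin : ∀ {u v x y z} → u ~ v → x ~ u → x ~ v → y ~ u → y ~ v → ¬ x ~ y → x ≢ y →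
                 z ~ u → z ≢ v → z ~ v
  diamond-twin {u} {v} {x} {y} {z} u~v x~u x~v y~u y~v x≁y x≢y z~u z≢v with z ~? v
  ... | yes z~v = z~v
  ... | no z≁v with z ~? x | z ~? y
  ...   | yes z~x | yes z~y = ⊥-elim (no-wheel wheel)
    where
    wheel : Wheel u x y v z
    wheel = record
      { c~a = ~-sym x~u ; c~b = ~-sym y~u ; c~d = u~v ; c~x = ~-sym z~u
      ; a~d = x~v ; a~x = ~-sym z~x ; b~d = y~v ; b~x = ~-sym z~y
      ; a≁b = x≁y ; d≁x = ≁-sym z≁v ; a≢b = x≢y ; d≢x = ≢-sym z≢v }
  ...   | yes z~x | no z≁y =
    ⊥-elim (diamond-¬one-sided-nbr u~v y~u y~v x~u x~v (≁-sym x≁y) (≢-sym x≢y) z~u z≁v z~x z≁y)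
  ...   | no z≁x | yes z~y =
    ⊥-elim (diamond-¬one-sided-nbr u~v x~u x~v y~u y~v x≁y x≢y z~u z≁v z~y z≁x)
  ...   | no z≁x | no z≁y = ⊥-elim (no-claw (~-sym x~u) (~-sym y~u) (~-sym z~u) x≢y x≢z y≢z
                                            x≁y (≁-sym z≁x) (≁-sym z≁y))
    where
    x≢z : x ≢ z
    x≢z refl = z≁v x~v
    y≢z : y ≢ z
    y≢z refl = z≁v y~v

  maxClique-unique-in-closedNbr : ∀ {u v w K C} → u ~ v → v ~ w → ¬ u ~ w → u ≢ w →
                                  IsMaxClique G K → IsMaxClique G C → u ∈ C → v ∈ C → v ∈ K →
                                  (∀ {k} → k ∈ K → k ~⁼ u) → K ≡ C
  maxClique-unique-in-closedNbr {u} {v} {w} {K} {C} u~v v~w u≁w u≢w maxK maxC u∈C v∈C v∈K near-u =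
    maximal-unique maxK maxC cross
    where
    cross : ∀ {a b} → a ∈ K → b ∈ C → a ≢ b → a ~ b
    cross {a} {b} a∈ b∈ a≢b with a ~? b
    ... | yes a~b = a~b
    ... | no a≁b with a ≟ v | b ≟ v
    ...   | yes refl | _ = ⊥-elim (a≁b (proj₁ maxC v∈C b∈ a≢b))
    ...   | no _ | yes refl = ⊥-elim (a≁b (proj₁ maxK a∈ v∈K a≢b))
    ...   | no a≢v | no b≢v with near-u a∈ | b ≟ u
    ...     | inj₁ refl | _ = ⊥-elim (a≁b (proj₁ maxC u∈C b∈ a≢b))
    ...     | inj₂ a~u | yes refl = ⊥-elim (a≁b a~u)
    ...     | inj₂ a~u | no b≢u =
      ⊥-elim (u≁w (~-sym (diamond-twin (~-sym u~v) (proj₁ maxK a∈ v∈K a≢v) a~u (proj₁ maxC b∈ v∈C b≢v)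
                                       (proj₁ maxC b∈ u∈C b≢u) a≁b a≢b (~-sym v~w) (≢-sym u≢w))))

  maxClique-through-nonSimplicial : ∀ {u v w K C₁ C₂} → v ~ u → v ~ w → ¬ u ~ w → u ≢ w →
                                    IsMaxClique G C₁ → u ∈ C₁ → v ∈ C₁ →
                                    IsMaxClique G C₂ → v ∈ C₂ → w ∈ C₂ →
                                    IsMaxClique G K → v ∈ K → K ≡ C₁ ⊎ K ≡ C₂
  maxClique-through-nonSimplicial {u} {v} {w} {K} v~u v~w u≁w u≢w maxC₁ u∈C₁ v∈C₁ maxC₂ v∈C₂ w∈C₂
                                  maxK v∈K
    with any? (λ k → k ∈? K ×-dec ¬? (k ≟ u) ×-dec ¬? (k ~? u))
  ... | no none =
    inj₁ (maxClique-unique-in-closedNbr (~-sym v~u) v~w u≁w u≢w maxK maxC₁ u∈C₁ v∈C₁ v∈K near-u)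
    where
    near-u : ∀ {k} → k ∈ K → k ~⁼ u
    near-u {k} k∈ with k ≟ u
    ... | yes k≡u = inj₁ k≡u
    ... | no k≢u = inj₂ (decidable-stable (k ~? u) (λ k≁u → none (k , k∈ , k≢u , k≁u)))
  ... | yes (k , k∈ , k≢u , k≁u) =
    inj₂ (maxClique-unique-in-closedNbr (~-sym v~w) v~u (≁-sym u≁w) (≢-sym u≢w)
                                        maxK maxC₂ w∈C₂ v∈C₂ v∈K near-w)
    where
    near-w : ∀ {k′} → k′ ∈ K → k′ ~⁼ w
    near-w {k′} k′∈ with w ∈? K | k′ ≟ w | k′ ~? w
    ... | yes w∈K | _ | _ = maxClique-~⁼ maxK k′∈ w∈K
    ... | no _ | yes k′≡w | _ = inj₁ k′≡w
    ... | no _ | no _ | yes k′~w = inj₂ k′~w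
    ... | no w∉K | no k′≢w | no k′≁w =
      ⊥-elim (k′≁w (~-sym (diamond-twin v~k′ (~-sym v~u) (~-sym k′~u) (~-sym v~k) k~k′
                                         (≁-sym k≁u) (≢-sym k≢u) (~-sym v~w) (≢-sym k′≢w))))
      where
      v~k : v ~ k
      v~k = proj₁ maxK v∈K k∈ λ { refl → k≁u v~u }
      v~k′ : v ~ k′
      v~k′ = proj₁ maxK v∈K k′∈ λ { refl → k′≁w v~w }
      k~w : k ~ w
      k~w with claw-pair v~k v~u v~w k≢u (λ { refl → w∉K k∈ }) u≢w u≁w
      ... | inj₁ k~u = ⊥-elim (k≁u k~u)
      ... | inj₂ k~w = k~w
      k′~u : k′ ~ u
      k′~u with claw-pair v~k′ v~u v~w (λ { refl → k≁u (proj₁ maxK k∈ k′∈ k≢u) }) k′≢w u≢w u≁w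
      ... | inj₁ k′~u = k′~u
      ... | inj₂ k′~w = ⊥-elim (k′≁w k′~w)
      k~k′ : k ~ k′
      k~k′ = proj₁ maxK k∈ k′∈ λ { refl → k′≁w k~w }

  maxCliques-Helly : ∀ {K₁ K₂ K₃ e₁ e₂ e₃} → IsMaxClique G K₁ → IsMaxClique G K₂ → IsMaxClique G K₃ →
                     e₁ ∈ K₁ → e₁ ∈ K₂ → e₂ ∈ K₂ → e₂ ∈ K₃ → e₃ ∈ K₁ → e₃ ∈ K₃ →
                     ∃[ v ] (v ∈ K₁ × v ∈ K₂ × v ∈ K₃)
  maxCliques-Helly {K₁} {K₂} {K₃} {e₁} {e₂} {e₃}
                   maxK₁ maxK₂ maxK₃ e₁∈K₁ e₁∈K₂ e₂∈K₂ e₂∈K₃ e₃∈K₁ e₃∈K₃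
    with e₂ ∈? K₁ | e₁ ≟ e₃
  ... | yes e₂∈K₁ | _ = e₂ , e₂∈K₁ , e₂∈K₂ , e₂∈K₃
  ... | no _ | yes refl = e₁ , e₁∈K₁ , e₁∈K₂ , e₃∈K₃
  ... | no e₂∉K₁ | no e₁≢e₃ with ∉⇒blocked maxK₁ e₂∉K₁
  ...   | y , y∈K₁ , y≢e₂ , y≁e₂ = e₃ , e₃∈K₁ , compatible⇒∈ maxK₂ e₃-compatible , e₃∈K₃
    where
    e₁~e₂ : e₁ ~ e₂
    e₁~e₂ = proj₁ maxK₂ e₁∈K₂ e₂∈K₂ λ { refl → e₂∉K₁ e₁∈K₁ }
    e₃~e₂ : e₃ ~ e₂
    e₃~e₂ = proj₁ maxK₃ e₃∈K₃ e₂∈K₃ λ { refl → e₂∉K₁ e₃∈K₁ }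
    e₁~e₃ : e₁ ~ e₃
    e₁~e₃ = proj₁ maxK₁ e₁∈K₁ e₃∈K₁ e₁≢e₃
    y~e₁ : y ~ e₁
    y~e₁ = proj₁ maxK₁ y∈K₁ e₁∈K₁ λ { refl → y≁e₂ e₁~e₂ }
    y~e₃ : y ~ e₃
    y~e₃ = proj₁ maxK₁ y∈K₁ e₃∈K₁ λ { refl → y≁e₂ e₃~e₂ }
    e₃-compatible : Compatible K₂ e₃
    e₃-compatible {z} z∈K₂ z≢e₃ with z ≟ e₁
    ... | yes refl = e₁~e₃
    ... | no z≢e₁ = diamond-twin e₁~e₃ y~e₁ y~e₃ (~-sym e₁~e₂) (~-sym e₃~e₂) y≁e₂ y≢e₂
                                 (proj₁ maxK₂ z∈K₂ e₁∈K₂ z≢e₁) z≢e₃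

lookup-injective : ∀ {A : Set} {xs : List A} → Unique xs →
                   ∀ i j → lookup xs i ≡ lookup xs j → i ≡ j
lookup-injective (_ ∷ _) zero zero _ = refl
lookup-injective (x∉xs ∷ _) zero (suc j) x≡ = ⊥-elim (All.lookup x∉xs (∈-lookup j) x≡)
lookup-injective (x∉xs ∷ _) (suc i) zero ≡x = ⊥-elim (All.lookup x∉xs (∈-lookup i) (sym ≡x))
lookup-injective (_ ∷ unique) (suc i) (suc j) eq = cong suc (lookup-injective unique i j eq)

module Enumeration {A : Set} (_≟ᴬ_ : DecidableEquality A) (xs : List A) where

  size : ℕ
  size = length (deduplicate _≟ᴬ_ xs)

  elem : Fin size → A
  elem = lookup (deduplicate _≟ᴬ_ xs)

  elem-injective : ∀ i j → elem i ≡ elem j → i ≡ j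
  elem-injective = lookup-injective (deduplicate-! _≟ᴬ_ xs)

  elem-∈ : ∀ i → elem i List.∈ xs
  elem-∈ i = ∈-deduplicate⁻ _≟ᴬ_ xs (∈-lookup i)

  index : ∀ {x} → x List.∈ xs → Fin size
  index x∈ = Any.index (∈-deduplicate⁺ _≟ᴬ_ x∈)

  elem-index : ∀ {x} (x∈ : x List.∈ xs) → elem (index x∈) ≡ x
  elem-index x∈ = sym (lookup-index (∈-deduplicate⁺ _≟ᴬ_ x∈))

module MultigraphBasics (M : Multigraph) where

  MReach-trans : ∀ {x y z} → MReach M x y → MReach M y z → MReach M x z
  MReach-trans here y⇝z = y⇝z
  MReach-trans (step x~y y⇝z) z⇝w = step x~y (MReach-trans y⇝z z⇝w)

  incident-reach : ∀ {e x y} → Incident M e x → Incident M e y → MReach M x y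
  incident-reach {e} (inj₁ refl) (inj₁ refl) = here
  incident-reach {e} (inj₁ refl) (inj₂ refl) = step (e , inj₁ (refl , refl)) here
  incident-reach {e} (inj₂ refl) (inj₁ refl) = step (e , inj₂ (refl , refl)) here
  incident-reach {e} (inj₂ refl) (inj₂ refl) = here

  MAdj⇒incident : ∀ {x y} → MAdj M x y → ∃[ e ] (Incident M e x × Incident M e y)
  MAdj⇒incident (e , inj₁ (refl , refl)) = e , inj₁ refl , inj₂ refl
  MAdj⇒incident (e , inj₂ (refl , refl)) = e , inj₂ refl , inj₁ refl

  MAdj⇒≢ : ∀ {x y} → MAdj M x y → x ≢ y
  MAdj⇒≢ (e , inj₁ (refl , refl)) = loopless M e
  MAdj⇒≢ (e , inj₂ (refl , refl)) x≡y = loopless M e (sym x≡y)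

  no-three-ends : ∀ {e x y z} → Incident M e x → Incident M e y → Incident M e z →
                  x ≢ y → y ≢ z → x ≢ z → ⊥
  no-three-ends (inj₁ refl) (inj₁ refl) _ x≢y _ _ = x≢y refl
  no-three-ends (inj₂ refl) (inj₂ refl) _ x≢y _ _ = x≢y refl
  no-three-ends (inj₁ refl) _ (inj₁ refl) _ _ x≢z = x≢z refl
  no-three-ends (inj₂ refl) _ (inj₂ refl) _ _ x≢z = x≢z refl
  no-three-ends _ (inj₁ refl) (inj₁ refl) _ y≢z _ = y≢z refl
  no-three-ends _ (inj₂ refl) (inj₂ refl) _ y≢z _ = y≢z refl

module RootMultigraph (G : Graph) (connected : Connected G) (coconnected : CoConnected G)
                      (claw-free : ClawFree G) (cis : IsCIS G) where

  open GraphBasics G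
  open MaximalCliques G connected coconnected claw-free cis

  -- inj₁ K is the maximal clique K, inj₂ v the pendant node of a simplicial vertex v.
  Node : Set
  Node = Subset N ⊎ Fin N

  IsNode : Node → Set
  IsNode (inj₁ K) = IsMaxClique G K
  IsNode (inj₂ v) = Simplicial v

  infix 4 _∈ⁿ_
  _∈ⁿ_ : Fin N → Node → Set
  v ∈ⁿ inj₁ K = v ∈ K
  v ∈ⁿ inj₂ w = w ≡ v

  record EndNodes (v : Fin N) : Set where
    field
      first second : Node
      first-node : IsNode first
      second-node : IsNode second
      ∈first : v ∈ⁿ first
      ∈second : v ∈ⁿ second
      first≢second : first ≢ second
      only : ∀ {X} → IsNode X → v ∈ⁿ X → X ≡ first ⊎ X ≡ second

  endNodes : ∀ v → EndNodes v
  endNodes v with nonSimplicial-or-simplicial v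
  ... | inj₁ (u , w , v~u , v~w , u≢w , u≁w) with maxClique-∋₂ v~u | maxClique-∋₂ v~w
  ...   | C₁ , maxC₁ , v∈C₁ , u∈C₁ | C₂ , maxC₂ , v∈C₂ , w∈C₂ = record
    { first = inj₁ C₁ ; second = inj₁ C₂ ; first-node = maxC₁ ; second-node = maxC₂
    ; ∈first = v∈C₁ ; ∈second = v∈C₂ ; first≢second = C₁≢C₂ ; only = only }
    where
    C₁≢C₂ : inj₁ C₁ ≢ inj₁ C₂
    C₁≢C₂ C₁≡C₂ = u≁w (proj₁ maxC₁ u∈C₁ (subst (w ∈_) (sym (inj₁-injective C₁≡C₂)) w∈C₂) u≢w)
    only : ∀ {X} → IsNode X → v ∈ⁿ X → X ≡ inj₁ C₁ ⊎ X ≡ inj₁ C₂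
    only {inj₁ K} maxK v∈K = map (cong inj₁) (cong inj₁)
      (maxClique-through-nonSimplicial v~u v~w u≁w u≢w maxC₁ u∈C₁ v∈C₁ maxC₂ v∈C₂ w∈C₂ maxK v∈K)
    only {inj₂ _} simplicial refl = ⊥-elim (u≁w (simplicial v~u v~w u≢w))
  endNodes v | inj₂ simplicial with maxClique-∋ v
  ... | K , maxK , v∈K = record
    { first = inj₁ K ; second = inj₂ v ; first-node = maxK ; second-node = simplicial
    ; ∈first = v∈K ; ∈second = refl ; first≢second = λ () ; only = only }
    where
    only : ∀ {X} → IsNode X → v ∈ⁿ X → X ≡ inj₁ K ⊎ X ≡ inj₂ v
    only {inj₁ K′} maxK′ v∈K′ =
      inj₁ (cong inj₁ (simplicial⇒unique-maxClique simplicial maxK′ maxK v∈K′ v∈K))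
    only {inj₂ _} _ refl = inj₂ refl

  open module EndNodesOf v = EndNodes (endNodes v) using (first; second)

  _≟ⁿ_ : DecidableEquality Node
  _≟ⁿ_ = Sum.≡-dec (Vec.≡-dec Bool._≟_) _≟_

  endNodeList : List Node
  endNodeList = concatMap (λ v → first v ∷ second v ∷ []) (allFin N)

  first∈list : ∀ v → first v List.∈ endNodeList
  first∈list v = ∈-concatMap⁺ _ (Any.map (λ { refl → here refl }) (∈-allFin v))

  second∈list : ∀ v → second v List.∈ endNodeList
  second∈list v = ∈-concatMap⁺ _ (Any.map (λ { refl → there (here refl) }) (∈-allFin v))

  listed-isNode : ∀ {X} → X List.∈ endNodeList → IsNode X × ∃[ v ] (v ∈ⁿ X)
  listed-isNode X∈ with Any.satisfied (∈-concatMap⁻ _ {xs = allFin N} X∈)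
  ... | v , here refl = EndNodesOf.first-node v , v , EndNodesOf.∈first v
  ... | v , there (here refl) = EndNodesOf.second-node v , v , EndNodesOf.∈second v

  open Enumeration _≟ⁿ_ endNodeList renaming (size to nodeCount; elem to node)

  first-index second-index : Fin N → Fin nodeCount
  first-index v = index (first∈list v)
  second-index v = index (second∈list v)

  root : Multigraph
  root = record
    { V = nodeCount
    ; E = N
    ; ends = λ v → first-index v , second-index v
    ; loopless = λ v same → EndNodesOf.first≢second v
        (trans (sym (elem-index (first∈list v))) (trans (cong node same) (elem-index (second∈list v))))
    }

  open MultigraphBasics root

  node-isNode : ∀ i → IsNode (node i)
  node-isNode i = proj₁ (listed-isNode (elem-∈ i))

  node-inhabited : ∀ i → ∃[ v ] (v ∈ⁿ node i)
  node-inhabited i = proj₂ (listed-isNode (elem-∈ i))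

  incident⇒∈ⁿ : ∀ {v i} → Incident root v i → v ∈ⁿ node i
  incident⇒∈ⁿ {v} (inj₁ refl) =
    subst (v ∈ⁿ_) (sym (elem-index (first∈list v))) (EndNodesOf.∈first v)
  incident⇒∈ⁿ {v} (inj₂ refl) =
    subst (v ∈ⁿ_) (sym (elem-index (second∈list v))) (EndNodesOf.∈second v)

  ∈ⁿ⇒incident : ∀ {v i} → v ∈ⁿ node i → Incident root v i
  ∈ⁿ⇒incident {v} {i} v∈i with EndNodesOf.only v (node-isNode i) v∈i
  ... | inj₁ i≡first = inj₁ (elem-injective _ i (trans (elem-index (first∈list v)) (sym i≡first)))
  ... | inj₂ i≡second = inj₂ (elem-injective _ i (trans (elem-index (second∈list v)) (sym i≡second)))

  node-index : ∀ {X v} → IsNode X → v ∈ⁿ X → ∃[ i ] (node i ≡ X)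
  node-index {X} {v} X-node v∈X with EndNodesOf.only v X-node v∈X
  ... | inj₁ X≡first = first-index v , trans (elem-index (first∈list v)) (sym X≡first)
  ... | inj₂ X≡second = second-index v , trans (elem-index (second∈list v)) (sym X≡second)

  ∈ⁿ-same⇒~ : ∀ {X u v} → IsNode X → u ∈ⁿ X → v ∈ⁿ X → u ≢ v → u ~ v
  ∈ⁿ-same⇒~ {inj₁ K} maxK u∈K v∈K = proj₁ maxK u∈K v∈K
  ∈ⁿ-same⇒~ {inj₂ w} _ refl refl u≢u = ⊥-elim (u≢u refl)

  ~⇒common-node : ∀ {u v} → u ~ v → ∃[ i ] (u ∈ⁿ node i × v ∈ⁿ node i)
  ~⇒common-node {u} {v} u~v with maxClique-∋₂ u~v
  ... | K , maxK , u∈K , v∈K with node-index {inj₁ K} maxK u∈K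
  ...   | i , i≡K = i , subst (u ∈ⁿ_) (sym i≡K) u∈K , subst (v ∈ⁿ_) (sym i≡K) v∈K

  G≅L[root] : G ≅ LineGraph root
  G≅L[root] = record { bij = ⤖-id (Fin N) ; pres = λ u v → mk⇔ to from }
    where
    to : ∀ {u v} → u ~ v → LAdj root u v
    to u~v with ~⇒common-node u~v
    ... | i , u∈i , v∈i = ~⇒≢ u~v , i , ∈ⁿ⇒incident u∈i , ∈ⁿ⇒incident v∈i
    from : ∀ {u v} → LAdj root u v → u ~ v
    from (u≢v , i , u-i , v-i) = ∈ⁿ-same⇒~ (node-isNode i) (incident⇒∈ⁿ u-i) (incident⇒∈ⁿ v-i) u≢v

  nodes-Helly : ∀ {X Y Z e₁ e₂ e₃} → IsNode X → IsNode Y → IsNode Z →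
                e₁ ∈ⁿ X → e₁ ∈ⁿ Y → e₂ ∈ⁿ Y → e₂ ∈ⁿ Z → e₃ ∈ⁿ X → e₃ ∈ⁿ Z →
                ∃[ v ] (v ∈ⁿ X × v ∈ⁿ Y × v ∈ⁿ Z)
  nodes-Helly {inj₂ w} _ _ _ refl e₁∈Y _ _ refl e₃∈Z = w , refl , e₁∈Y , e₃∈Z
  nodes-Helly {Y = inj₂ w} _ _ _ e₁∈X refl refl e₂∈Z _ _ = w , e₁∈X , refl , e₂∈Z
  nodes-Helly {Z = inj₂ w} _ _ _ _ _ e₂∈Y refl e₃∈X refl = w , e₃∈X , e₂∈Y , refl
  nodes-Helly {inj₁ _} {inj₁ _} {inj₁ _} maxK₁ maxK₂ maxK₃ = maxCliques-Helly maxK₁ maxK₂ maxK₃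

  root-triangleFree : TriangleFree root
  root-triangleFree i j k (i~j , j~k , i~k)
    with MAdj⇒incident i~j | MAdj⇒incident j~k | MAdj⇒incident i~k
  ... | e₁ , e₁-i , e₁-j | e₂ , e₂-j , e₂-k | e₃ , e₃-i , e₃-k
    with nodes-Helly (node-isNode i) (node-isNode j) (node-isNode k)
           (incident⇒∈ⁿ e₁-i) (incident⇒∈ⁿ e₁-j) (incident⇒∈ⁿ e₂-j) (incident⇒∈ⁿ e₂-k)
           (incident⇒∈ⁿ e₃-i) (incident⇒∈ⁿ e₃-k)
  ...   | v , v∈i , v∈j , v∈k =
    no-three-ends (∈ⁿ⇒incident v∈i) (∈ⁿ⇒incident v∈j) (∈ⁿ⇒incident v∈k)
                  (MAdj⇒≢ i~j) (MAdj⇒≢ j~k) (MAdj⇒≢ i~k)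

  reach-lift : ∀ {u w i j} → Reach G _~_ u w → Incident root u i → Incident root w j → MReach root i j
  reach-lift here u-i u-j = incident-reach u-i u-j
  reach-lift (step u~u′ u′⇝w) u-i w-j with ~⇒common-node u~u′
  ... | k , u∈k , u′∈k =
    MReach-trans (incident-reach u-i (∈ⁿ⇒incident u∈k)) (reach-lift u′⇝w (∈ⁿ⇒incident u′∈k) w-j)

  root-connected : MConnected root
  root-connected i j with node-inhabited i | node-inhabited j
  ... | u , u∈i | w , w∈j = reach-lift (connected u w) (∈ⁿ⇒incident u∈i) (∈ⁿ⇒incident w∈j)

corollary9 : (G : Graph) → Connected G → CoConnected G → ClawFree G → IsCIS G →
    ∃[ M ] (MConnected M × TriangleFree M × (G ≅ LineGraph M))
corollary9 G connected coconnected claw-free cis = root , root-connected , root-triangleFree , G≅L[root]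
  where open RootMultigraph G connected coconnected claw-free cis
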